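{- Let $p$ be an odd prime and $r$ a positive integer. Then $$\sum_{k=0}^{p^r-1}\frac{1}{2^k(2k-1)}\binom{2k}{k}\equiv(-1)^{(p^r-1)/2}+2p^r\pmod{p^2}.$$
   Context: The congruence is understood for rational numbers whose denominators are coprime to $p$. -}

module Defs where

open import Data.Nat as ℕ using (ℕ; zero; suc; _∸_)
open import Data.Nat.Properties using (m^n≢0)
open import Data.Nat.Combinatorics using (_C_)
open import Data.Nat.Coprimality using (Coprime)
open import Data.Nat.Divisibility using (_∣_)
open import Data.Integer as ℤ using (ℤ; +_)
open import Data.Rational using (ℚ; _/_; _+_; _-_; _*_; -_; 0ℚ; 1ℚ; ↥_; ↧ₙ_)
open import Data.List using (List; foldr; map; upTo)
open import Data.Product using (_×_)

sumℚ : List ℚ → ℚ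
sumℚ = foldr _+_ 0ℚ

Σ<ℚ : ℕ → (ℕ → ℚ) → ℚ
Σ<ℚ n f = sumℚ (map f (upTo n))

-- The summand  binom(2k,k) / (2^k (2k-1)).
-- For k = 0 the factor 2k-1 equals -1, so the term is -1;
-- for k = suc j we have 2k-1 = 2j+1 > 0.
term : ℕ → ℚ
term zero    = - 1ℚ
term (suc j) =
  ((+ ((2 ℕ.* suc j) C suc j)) / (2 ℕ.^ suc j)) {{m^n≢0 2 (suc j)}}
    * ((+ 1) / suc (2 ℕ.* j))

-- Congruence of rationals modulo p^e (p prime): a ≡ b (mod p^e) iff
-- a - b = p^e * (a rational whose denominator is coprime to p), i.e. the
-- reduced fraction a - b has numerator divisible by p^e and denominator
-- coprime to p.
_≡_[mod_^_] : ℚ → ℚ → ℕ → ℕ → Set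
a ≡ b [mod p ^ e ] =
  (p ℕ.^ e ∣ ℤ.∣ ↥ (a - b) ∣) × Coprime (↧ₙ (a - b)) p

module Submission where

-- Multiplying by 2^n turns the sum into an integer W n, which telescopes to
-- W n = 2 R(2n,n) - 4 C(2n-2,n-1), where R N m = Σ_i C(N,i) t(m-i) convolves
-- row N of Pascal's triangle with t m = Im(i^m); X = R n n = Im (1+i)^n and
-- 2X² = 2^n for odd n.  As p divides every interior C(n,i), row n is 1 + x^n
-- mod p, and composing it with itself (row 2n = row n ∘ row n) gives the
-- double-row congruence  P (2n) g n ≡ 2 P n g n - g n (mod p²)  for every g:
-- for g = t it yields R(2n,n) ≡ 2X - ε, for g = δ it yields C(2n,n) ≡ 2, where
-- ε = t n = (-1)^((n-1)/2) ≡ X (mod p).  With n C(2n,n) = 2(2n-1) C(2n-2,n-1),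
-- a ring identity gives p² ∣ W n - 2^n(ε + 2n).  Finally the rational difference
-- is this integer over 2^n, and p ∤ 2^n.

open import Defs

module FiniteSums where
  open import Data.Nat using (ℕ; zero; suc; _≤_; z≤n)
  open import Data.Nat.Properties using (≤-refl; m≤n⇒m≤1+n)
  open import Data.Integer using (ℤ; _+_; _*_; -_; 0ℤ)
  open import Data.Integer.Properties using (+-assoc; neg-distrib-+)
  open import Data.Integer.Divisibility.Signed using (_∣_; divides; ∣m∣n⇒∣m+n)
  open import Data.Integer.Tactic.RingSolver using (solve-∀)
  open import Relation.Binary.PropositionalEquality using (_≡_; refl; sym; cong₂)

  ∣-* : ∀ {a b c d} → a ∣ b → c ∣ d → a * c ∣ b * d
  ∣-* {a} {c = c} (divides q refl) (divides q′ refl) = divides (q * q′) (regroup q a q′ c)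
    where
    regroup : ∀ q a q′ c → q * a * (q′ * c) ≡ q * q′ * (a * c)
    regroup = solve-∀

  sumTo : ℕ → (ℕ → ℤ) → ℤ
  sumTo zero    g = g 0
  sumTo (suc m) g = sumTo m g + g (suc m)

  sum-cong : ∀ m {f g : ℕ → ℤ} → (∀ i → i ≤ m → f i ≡ g i) → sumTo m f ≡ sumTo m g
  sum-cong zero    f≡g = f≡g 0 z≤n
  sum-cong (suc m) f≡g =
    cong₂ _+_ (sum-cong m (λ i i≤m → f≡g i (m≤n⇒m≤1+n i≤m))) (f≡g (suc m) ≤-refl)

  sum-+ : ∀ m (f g : ℕ → ℤ) → sumTo m (λ i → f i + g i) ≡ sumTo m f + sumTo m g
  sum-+ zero    f g = refl
  sum-+ (suc m) f g rewrite sum-+ m f g = interchange (sumTo m f) (sumTo m g) (f (suc m)) (g (suc m))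
    where
    interchange : ∀ a b c d → a + b + (c + d) ≡ a + c + (b + d)
    interchange = solve-∀

  sum-neg : ∀ m (f : ℕ → ℤ) → sumTo m (λ i → - f i) ≡ - sumTo m f
  sum-neg zero    f = refl
  sum-neg (suc m) f rewrite sum-neg m f = sym (neg-distrib-+ (sumTo m f) (f (suc m)))

  sum-zero : ∀ m → sumTo m (λ _ → 0ℤ) ≡ 0ℤ
  sum-zero zero    = refl
  sum-zero (suc m) rewrite sum-zero m = refl

  sum-front : ∀ m (g : ℕ → ℤ) → sumTo (suc m) g ≡ g 0 + sumTo m (λ i → g (suc i))
  sum-front zero    g = refl
  sum-front (suc m) g rewrite sum-front m g = +-assoc (g 0) (sumTo m (λ i → g (suc i))) (g (suc (suc m)))

  sum-∣ : ∀ {d} m (f : ℕ → ℤ) → (∀ i → i ≤ m → d ∣ f i) → d ∣ sumTo m f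
  sum-∣ zero    f d∣f = d∣f 0 z≤n
  sum-∣ (suc m) f d∣f =
    ∣m∣n⇒∣m+n (sum-∣ m f (λ i i≤m → d∣f i (m≤n⇒m≤1+n i≤m))) (d∣f (suc m) ≤-refl)

-- The Pascal convolution  P N g m = Σ_{i ≤ m} C(N,i) g(m-i),  i.e. the
-- coefficient of x^m in (1+x)^N · Σ g(j) x^j.  Viewed as an array in (N,m)
-- it satisfies Pascal's rule; comparing with this recursion gives the
-- composition law P (M+N) = P M ∘ P N (Vandermonde) and P N δ = C(N,·).
module PascalConvolution where
  open import Data.Nat as ℕ using (ℕ; zero; suc; _∸_)
  open import Data.Nat.Combinatorics using (_C_; nCk+nC[k+1]≡[n+1]C[k+1])
  open import Data.Integer using (ℤ; +_; _+_; _*_; 0ℤ; 1ℤ)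
  open import Data.Integer.Properties
    using (+-comm; +-assoc; +-identityʳ; *-identityˡ; *-distribʳ-+; pos-+)
  open import Relation.Binary.PropositionalEquality
    using (_≡_; refl; sym; trans; cong; cong₂; module ≡-Reasoning)
  open FiniteSums

  C' : ℕ → ℕ → ℤ
  C' n k = + (n C k)

  pascal : ∀ n k → C' (suc n) (suc k) ≡ C' n k + C' n (suc k)
  pascal n k = trans (cong +_ (sym (nCk+nC[k+1]≡[n+1]C[k+1] n k))) (pos-+ (n C k) (n C suc k))

  P : ℕ → (ℕ → ℤ) → ℕ → ℤ
  P N g m = sumTo m (λ i → C' N i * g (m ∸ i))

  P-col0 : ∀ N g → P N g 0 ≡ g 0
  P-col0 N g = *-identityˡ (g 0)

  P-row0 : ∀ g m → P 0 g m ≡ g m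
  P-row0 g zero    = *-identityˡ (g 0)
  P-row0 g (suc m) = begin
      P 0 g (suc m)
    ≡⟨ sum-front m _ ⟩
      1ℤ * g (suc m) + sumTo m (λ i → 0ℤ * g (m ∸ i))
    ≡⟨ cong₂ _+_ (*-identityˡ (g (suc m))) (sum-zero m) ⟩
      g (suc m) + 0ℤ
    ≡⟨ +-identityʳ (g (suc m)) ⟩
      g (suc m)
    ∎
    where open ≡-Reasoning

  P-pascal : ∀ N g m → P (suc N) g (suc m) ≡ P N g (suc m) + P N g m
  P-pascal N g m = begin
      P (suc N) g (suc m)
    ≡⟨ sum-front m _ ⟩
      1ℤ * g (suc m) + sumTo m (λ i → C' (suc N) (suc i) * g (m ∸ i))
    ≡⟨ cong (λ s → 1ℤ * g (suc m) + s) (sum-cong m (λ i _ → split-row i)) ⟩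
      1ℤ * g (suc m) + sumTo m (λ i → C' N (suc i) * g (m ∸ i) + C' N i * g (m ∸ i))
    ≡⟨ cong (λ s → 1ℤ * g (suc m) + s) (sum-+ m _ _) ⟩
      1ℤ * g (suc m) + (sumTo m (λ i → C' N (suc i) * g (m ∸ i)) + P N g m)
    ≡⟨ sym (+-assoc (1ℤ * g (suc m)) _ _) ⟩
      (1ℤ * g (suc m) + sumTo m (λ i → C' N (suc i) * g (m ∸ i))) + P N g m
    ≡⟨ cong (_+ P N g m) (sym (sum-front m _)) ⟩
      P N g (suc m) + P N g m
    ∎
    where
    open ≡-Reasoning
    split-row : ∀ i → C' (suc N) (suc i) * g (m ∸ i) ≡ C' N (suc i) * g (m ∸ i) + C' N i * g (m ∸ i)
    split-row i = trans (cong (_* g (m ∸ i)) (trans (pascal N i) (+-comm (C' N i) (C' N (suc i)))))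
                        (*-distribʳ-+ (g (m ∸ i)) (C' N (suc i)) (C' N i))

  pascal-unique : (A B : ℕ → ℕ → ℤ) →
    (∀ m → A 0 m ≡ B 0 m) → (∀ N → A N 0 ≡ B N 0) →
    (∀ N m → A (suc N) (suc m) ≡ A N (suc m) + A N m) →
    (∀ N m → B (suc N) (suc m) ≡ B N (suc m) + B N m) →
    ∀ N m → A N m ≡ B N m
  pascal-unique A B row col recA recB = go
    where
    go : ∀ N m → A N m ≡ B N m
    go zero    m       = row m
    go (suc N) zero    = col (suc N)
    go (suc N) (suc m) = trans (recA N m) (trans (cong₂ _+_ (go N (suc m)) (go N m)) (sym (recB N m)))

  P-compose : ∀ N (f : ℕ → ℤ) M m → P (M ℕ.+ N) f m ≡ P M (P N f) m
  P-compose N f = pascal-unique (λ M m → P (M ℕ.+ N) f m) (λ M m → P M (P N f) m)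
    (λ m → sym (P-row0 (P N f) m))
    (λ M → trans (P-col0 (M ℕ.+ N) f) (trans (sym (P-col0 N f)) (sym (P-col0 M (P N f)))))
    (λ M m → P-pascal (M ℕ.+ N) f m) (λ M m → P-pascal M (P N f) m)

  δ : ℕ → ℤ
  δ zero    = 1ℤ
  δ (suc _) = 0ℤ

  P-δ : ∀ N m → P N δ m ≡ C' N m
  P-δ = pascal-unique (λ N m → P N δ m) C' row0 (λ N → refl) (λ N m → P-pascal N δ m)
    (λ N m → trans (pascal N m) (+-comm (C' N m) (C' N (suc m))))
    where
    row0 : ∀ m → P 0 δ m ≡ C' 0 m
    row0 zero    = refl
    row0 (suc m) = P-row0 δ (suc m)

module BinomialFacts where
  open import Data.Nat using (zero; suc; _+_; _*_; _^_; _<_; >-nonZero)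
  open import Data.Nat.Properties
    using (+-identityʳ; *-zeroʳ; *-identityʳ; *-comm; *-assoc; +-comm; +-suc; ≤-trans; n≤1+n; m≤m+n;
           +-∸-assoc; m+n∸n≡m; <⇒≱)
  open import Data.Nat.Combinatorics using (_C_; nCk+nC[k+1]≡[n+1]C[k+1]; nC1≡n; nCk≡nC[n∸k])
  open import Data.Nat.Divisibility
    using (_∣_; divides; _∣?_; ∣-trans; m∣m*n; *-monoʳ-∣; *-cancelˡ-∣; ∣⇒≤; 1∣_)
  open import Data.Nat.Primality using (Prime; euclidsLemma; prime⇒nonZero)
  open import Data.Sum using (inj₁; inj₂)
  open import Relation.Nullary using (¬_; yes; no)
  open import Relation.Nullary.Negation using (contradiction)
  open import Relation.Binary.PropositionalEquality
    using (_≡_; refl; sym; trans; cong; cong₂; subst; module ≡-Reasoning)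
  open import Data.Nat.Tactic.RingSolver using (solve-∀)

  absorption : ∀ m k → suc k * (suc m C suc k) ≡ suc m * (m C k)
  absorption zero    zero    = refl
  absorption zero    (suc k) = *-zeroʳ (suc (suc k))
  absorption (suc m) zero    =
    trans (+-identityʳ (suc (suc m) C 1)) (trans (nC1≡n (suc (suc m))) (sym (*-identityʳ (suc (suc m)))))
  absorption (suc m) (suc k) = begin
      suc (suc k) * (suc (suc m) C suc (suc k))
    ≡⟨ cong (suc (suc k) *_) (sym (nCk+nC[k+1]≡[n+1]C[k+1] (suc m) (suc k))) ⟩
      suc (suc k) * (suc m C suc k + suc m C suc (suc k))
    ≡⟨ expand (suc k) (suc m C suc k) (suc m C suc (suc k)) ⟩
      suc k * (suc m C suc k) + suc m C suc k + suc (suc k) * (suc m C suc (suc k))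
    ≡⟨ cong₂ (λ a b → a + suc m C suc k + b) (absorption m k) (absorption m (suc k)) ⟩
      suc m * (m C k) + suc m C suc k + suc m * (m C suc k)
    ≡⟨ collect (suc m) (m C k) (suc m C suc k) (m C suc k) ⟩
      suc m * (m C k + m C suc k) + suc m C suc k
    ≡⟨ cong (λ z → suc m * z + suc m C suc k) (nCk+nC[k+1]≡[n+1]C[k+1] m k) ⟩
      suc m * (suc m C suc k) + suc m C suc k
    ≡⟨ +-comm (suc m * (suc m C suc k)) _ ⟩
      suc (suc m) * (suc m C suc k)
    ∎
    where
    open ≡-Reasoning
    expand : ∀ a x y → suc a * (x + y) ≡ a * x + x + suc a * y
    expand = solve-∀
    collect : ∀ a x y z → a * x + y + a * z ≡ a * (x + z) + y
    collect = solve-∀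

  central-recurrence : ∀ j → suc j * ((suc j + suc j) C suc j) ≡ 2 * suc (j + j) * ((j + j) C j)
  central-recurrence j = begin
      suc j * ((suc j + suc j) C suc j)
    ≡⟨ cong (λ z → suc j * (z C suc j)) (cong suc (+-suc j j)) ⟩
      suc j * (suc (suc (j + j)) C suc j)
    ≡⟨ absorption (suc (j + j)) j ⟩
      suc (suc (j + j)) * (suc (j + j) C j)
    ≡⟨ cong (suc (suc (j + j)) *_) symmetry ⟩
      suc (suc (j + j)) * (suc (j + j) C suc j)
    ≡⟨ double j (suc (j + j) C suc j) ⟩
      2 * (suc j * (suc (j + j) C suc j))
    ≡⟨ cong (2 *_) (absorption (j + j) j) ⟩
      2 * (suc (j + j) * ((j + j) C j))
    ≡⟨ sym (*-assoc 2 (suc (j + j)) _) ⟩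
      2 * suc (j + j) * ((j + j) C j)
    ∎
    where
    open ≡-Reasoning
    symmetry : suc (j + j) C j ≡ suc (j + j) C suc j
    symmetry = trans (nCk≡nC[n∸k] (≤-trans (m≤m+n j j) (n≤1+n _)))
                     (cong (suc (j + j) C_) (trans (+-∸-assoc 1 (m≤m+n j j)) (cong suc (m+n∸n≡m j j))))
    double : ∀ j x → suc (suc (j + j)) * x ≡ 2 * (suc j * x)
    double = solve-∀

  prime-power-cancel : ∀ {p} → Prime p → ∀ r i c → ¬ (p ∣ c) → p ^ r ∣ i * c → p ^ r ∣ i
  prime-power-cancel pp zero    i c _   _ = 1∣ i
  prime-power-cancel {p} pp (suc r) i c p∤c p^r+1∣ic
    with euclidsLemma i c pp (∣-trans (m∣m*n (p ^ r)) p^r+1∣ic)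
  ... | inj₂ p∣c = contradiction p∣c p∤c
  ... | inj₁ (divides i′ refl) = subst (p ^ suc r ∣_) (*-comm p i′) (*-monoʳ-∣ p p^r∣i′)
    where
    instance _ = prime⇒nonZero pp
    reassociate : ∀ a b c → a * b * c ≡ b * (a * c)
    reassociate = solve-∀
    p^r∣i′ : p ^ r ∣ i′
    p^r∣i′ = prime-power-cancel pp r i′ c p∤c
               (*-cancelˡ-∣ p (subst (p * p ^ r ∣_) (reassociate i′ p c) p^r+1∣ic))

  prime-power-binomial : ∀ {p} → Prime p → ∀ r i → 0 < i → i < p ^ r → p ∣ (p ^ r) C i
  prime-power-binomial {p} pp r i 0<i i<p^r with p ∣? ((p ^ r) C i)
  ... | yes p∣C = p∣C
  ... | no  p∤C = contradiction (∣⇒≤ {{>-nonZero 0<i}} p^r∣i) (<⇒≱ i<p^r)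
    where
    -- i C(n,i) = n C(n-1,i-1) is a multiple of n.
    multiple : ∀ i n → 0 < i → i < n → n ∣ i * (n C i)
    multiple (suc k) (suc m) _ _ = divides (m C k) (trans (absorption m k) (*-comm (suc m) (m C k)))
    p^r∣i : p ^ r ∣ i
    p^r∣i = prime-power-cancel pp r i _ p∤C (multiple i (p ^ r) 0<i i<p^r)

-- The sequence t = (0, 1, 0, -1, 0, 1, …), t m = Im(i^m), and its Pascal
-- convolutions R N m = Σ_i C(N,i) t(m-i) = Im(i^m (1-i)^N) for m ≥ N.
-- In particular X n = R n n = Im (1+i)^n and Y n = R n (n+1) = Re (1+i)^n,
-- so X² + Y² = |1+i|^(2n) = 2^n, and for odd n one has X² = Y² = 2^(n-1).
module ImaginaryParts where
  open import Data.Nat as ℕ using (ℕ; zero; suc; _∸_)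
  open import Data.Nat.Properties using (+-∸-assoc; n∸n≡0; n<1+n; +-suc)
  open import Data.Nat.Combinatorics using (k>n⇒nCk≡0)
  open import Data.Integer using (ℤ; +_; _+_; _*_; -_; _-_; _^_; 0ℤ; 1ℤ; -1ℤ)
  open import Data.Integer.Properties using (neg-distribʳ-*; pos-*; -1*i≡-i)
  open import Relation.Binary.PropositionalEquality
    using (_≡_; refl; sym; trans; cong; cong₂; module ≡-Reasoning)
  open import Data.Integer.Tactic.RingSolver using (solve-∀)
  open FiniteSums
  open PascalConvolution

  t : ℕ → ℤ
  t zero          = 0ℤ
  t (suc zero)    = 1ℤ
  t (suc (suc j)) = - t j

  R : ℕ → ℕ → ℤ
  R N m = P N t m

  R-shift : ∀ N m → R N (suc (suc m)) ≡ C' N (suc m) - R N m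
  R-shift N m = begin
      R N (suc (suc m))
    ≡⟨⟩
      sumTo m h + h (suc m) + h (suc (suc m))
    ≡⟨ cong₂ (λ a b → a + b + h (suc (suc m))) lower-terms (cong (λ z → C' N (suc m) * t z) (1+m∸m m)) ⟩
      - R N m + C' N (suc m) * 1ℤ + h (suc (suc m))
    ≡⟨ cong (λ z → - R N m + C' N (suc m) * 1ℤ + C' N (suc (suc m)) * t z) (n∸n≡0 (suc (suc m))) ⟩
      - R N m + C' N (suc m) * 1ℤ + C' N (suc (suc m)) * 0ℤ
    ≡⟨ simplify (R N m) (C' N (suc m)) (C' N (suc (suc m))) ⟩
      C' N (suc m) - R N m
    ∎
    where
    open ≡-Reasoning
    h : ℕ → ℤ
    h i = C' N i * t (suc (suc m) ∸ i)
    1+m∸m : ∀ m → suc m ∸ m ≡ 1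
    1+m∸m zero    = refl
    1+m∸m (suc m) = 1+m∸m m
    lower-terms : sumTo m h ≡ - R N m
    lower-terms = trans (sum-cong m (λ i i≤m → trans (cong (λ z → C' N i * t z) (+-∸-assoc 2 i≤m))
                                                      (sym (neg-distribʳ-* (C' N i) (t (m ∸ i))))))
                        (sum-neg m _)
    simplify : ∀ a b c → - a + b * 1ℤ + c * 0ℤ ≡ b - a
    simplify = solve-∀

  X Y : ℕ → ℤ
  X n = R n n
  Y n = R n (suc n)

  -- (1+i)^(n+1) = (1+i)^n (1+i), in coordinates.
  X-step : ∀ n → X (suc n) ≡ Y n + X n
  X-step n = P-pascal n t n

  Y-step : ∀ n → Y (suc n) ≡ Y n - X n
  Y-step n = begin
      Y (suc n)
    ≡⟨ P-pascal n t (suc n) ⟩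
      R n (suc (suc n)) + Y n
    ≡⟨ cong (_+ Y n) (R-shift n n) ⟩
      C' n (suc n) - X n + Y n
    ≡⟨ cong (λ z → + z - X n + Y n) (k>n⇒nCk≡0 (n<1+n n)) ⟩
      0ℤ - X n + Y n
    ≡⟨ reorder (X n) (Y n) ⟩
      Y n - X n
    ∎
    where
    open ≡-Reasoning
    reorder : ∀ x y → 0ℤ - x + y ≡ y - x
    reorder = solve-∀

  norm : ∀ n → X n * X n + Y n * Y n ≡ + (2 ℕ.^ n)
  norm zero    = refl
  norm (suc n) rewrite X-step n | Y-step n =
    trans (expand (X n) (Y n)) (trans (cong (+ 2 *_) (norm n)) (sym (pos-* 2 (2 ℕ.^ n))))
    where
    expand : ∀ x y → (y + x) * (y + x) + (y - x) * (y - x) ≡ + 2 * (x * x + y * y)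
    expand = solve-∀

  -- Re((1+i)^(2n)) = Y² - X² is multiplied by -4 under n ↦ n+2, since (1+i)^4 = -4.
  difference : ℕ → ℤ
  difference n = Y n * Y n - X n * X n

  difference-step : ∀ n → difference (suc (suc n)) ≡ - + 4 * difference n
  difference-step n rewrite X-step (suc n) | Y-step (suc n) | X-step n | Y-step n = expand (X n) (Y n)
    where
    expand : ∀ x y → (y - x - (y + x)) * (y - x - (y + x)) - (y - x + (y + x)) * (y - x + (y + x))
                   ≡ - + 4 * (y * y - x * x)
    expand = solve-∀

  difference-odd : ∀ h → difference (suc (h ℕ.+ h)) ≡ 0ℤ
  difference-odd zero    = refl
  difference-odd (suc h) rewrite +-suc h h =
    trans (difference-step (suc (h ℕ.+ h))) (cong (- + 4 *_) (difference-odd h))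

  X-square-odd : ∀ h → let n = suc (h ℕ.+ h) in + 2 * (X n * X n) ≡ + (2 ℕ.^ n)
  X-square-odd h = trans (split (X n) (Y n))
    (trans (cong₂ _-_ (norm n) (difference-odd h)) (minus-zero (+ (2 ℕ.^ n))))
    where
    n : ℕ
    n = suc (h ℕ.+ h)
    split : ∀ x y → + 2 * (x * x) ≡ (x * x + y * y) - (y * y - x * x)
    split = solve-∀
    minus-zero : ∀ a → a - 0ℤ ≡ a
    minus-zero = solve-∀

  t-odd : ∀ h → t (suc (h ℕ.+ h)) ≡ -1ℤ ^ h
  t-odd zero    = refl
  t-odd (suc h) rewrite +-suc h h = trans (cong -_ (t-odd h)) (sym (-1*i≡-i _))

  sign-square : ∀ h → (-1ℤ ^ h) * (-1ℤ ^ h) ≡ 1ℤ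
  sign-square zero    = refl
  sign-square (suc h) = trans (cancel-signs (-1ℤ ^ h)) (sign-square h)
    where
    cancel-signs : ∀ e → (-1ℤ * e) * (-1ℤ * e) ≡ e * e
    cancel-signs = solve-∀

-- Let n ≥ 2 be such that p divides every interior binomial coefficient
-- C(n,i), 0 < i < n (e.g. n a power of p).  Then row n of Pascal's triangle
-- is ≡ 1 + x^n (mod p), and composing it with itself shows that for every
-- sequence g
--   P (n+n) g n ≡ 2 P n g n - g n   (mod p²).
module RowSquaring where
  open import Data.Nat as ℕ using (ℕ; zero; suc; _∸_; _<_; _≤_; s≤s; z≤n)
  open import Data.Nat.Properties using (n∸n≡0; m∸n≤m; <-≤-trans)
  open import Data.Nat.Combinatorics using (_C_; nCn≡1)
  import Data.Nat.Divisibility as ℕ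
  open import Data.Integer using (ℤ; +_; _+_; _*_; -_; _-_; 0ℤ; 1ℤ)
  open import Data.Integer.Properties using (*-identityˡ)
  open import Data.Integer.Divisibility.Signed using (_∣_; divides; ∣ᵤ⇒∣; ∣m⇒∣m*n)
  open import Relation.Binary.PropositionalEquality
    using (_≡_; sym; trans; cong; cong₂; subst; module ≡-Reasoning)
  open import Data.Integer.Tactic.RingSolver using (solve-∀)
  open FiniteSums
  open PascalConvolution

  module DoubleRow (p k : ℕ) (interior : ∀ i → 0 < i → i < suc (suc k) → p ℕ.∣ suc (suc k) C i) where

    n : ℕ
    n = suc (suc k)

    interior-∣ : ∀ i → 0 < i → i < n → + p ∣ C' n i
    interior-∣ i 0<i i<n = ∣ᵤ⇒∣ (interior i 0<i i<n)

    -- The interior part  Σ_{0<i<n} C(n,i) g(n-i)  of the convolution with row n.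
    inner : (ℕ → ℤ) → ℤ
    inner g = sumTo k (λ j → C' n (suc j) * g (n ∸ suc j))

    inner-∣ : ∀ j → j ≤ k → + p ∣ C' n (suc j)
    inner-∣ j j≤k = interior-∣ (suc j) (s≤s z≤n) (s≤s (s≤s j≤k))

    P-split : ∀ g → P n g n ≡ g n + inner g + g 0
    P-split g = begin
        sumTo (suc k) F + F n
      ≡⟨ cong (_+ F n) (sum-front k F) ⟩
        1ℤ * g n + inner g + C' n n * g (n ∸ n)
      ≡⟨ cong₂ (λ a b → a + inner g + b) (*-identityˡ (g n)) last-term ⟩
        g n + inner g + g 0
      ∎
      where
      open ≡-Reasoning
      F : ℕ → ℤ
      F i = C' n i * g (n ∸ i)
      last-term : C' n n * g (n ∸ n) ≡ g 0
      last-term = trans (cong₂ (λ c m → + c * g m) (nCn≡1 n) (n∸n≡0 n)) (*-identityˡ (g 0))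

    -- On the diagonal, only the two extreme terms survive mod p.
    diagonal-mod-p : ∀ g → + p ∣ P n g n - (g n + g 0)
    diagonal-mod-p g = subst (+ p ∣_) (sym (trans (cong (_- (g n + g 0)) (P-split g)) (cancel (g n) (inner g) (g 0))))
      (sum-∣ k _ (λ j j≤k → ∣m⇒∣m*n (g (n ∸ suc j)) (inner-∣ j j≤k)))
      where
      cancel : ∀ a i b → a + i + b - (a + b) ≡ i
      cancel = solve-∀

    P-mod-p : ∀ g m → m < n → + p ∣ P n g m - g m
    P-mod-p g zero    _     = divides 0ℤ (cancel (g 0) (+ p))
      where
      cancel : ∀ a q → 1ℤ * a - a ≡ 0ℤ * q
      cancel = solve-∀
    P-mod-p g (suc m) m<n = subst (+ p ∣_) (sym higher-terms)
      (sum-∣ m _ (λ i i≤m → ∣m⇒∣m*n (g (m ∸ i))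
        (interior-∣ (suc i) (s≤s z≤n) (<-≤-trans (s≤s (s≤s i≤m)) m<n))))
      where
      cancel : ∀ a s → 1ℤ * a + s - a ≡ s
      cancel = solve-∀
      higher-terms : P n g (suc m) - g (suc m) ≡ sumTo m (λ i → C' n (suc i) * g (m ∸ i))
      higher-terms = trans (cong (_- g (suc m)) (sum-front m _)) (cancel (g (suc m)) _)

    inner-mod-p² : ∀ g → + p * + p ∣ inner (P n g) - inner g
    inner-mod-p² g = subst (+ p * + p ∣_) (sym difference)
      (sum-∣ k _ (λ j j≤k → ∣-* (inner-∣ j j≤k) (P-mod-p g (n ∸ suc j) (s≤s (m∸n≤m (suc k) j)))))
      where
      distribute : ∀ c a b → c * a + - (c * b) ≡ c * (a - b)
      distribute = solve-∀
      difference : inner (P n g) - inner g ≡ sumTo k (λ j → C' n (suc j) * (P n g (n ∸ suc j) - g (n ∸ suc j)))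
      difference = trans (cong (λ s → inner (P n g) + s) (sym (sum-neg k _)))
                  (trans (sym (sum-+ k _ _))
                  (sum-cong k (λ j _ → distribute (C' n (suc j)) (P n g (n ∸ suc j)) (g (n ∸ suc j)))))

    -- P (n+n) g n = P n (P n g) n = P n g n + inner (P n g) + g 0, while
    -- 2 P n g n - g n = P n g n + inner g + g 0.
    double-row : ∀ g → + p * + p ∣ P (n ℕ.+ n) g n - (+ 2 * P n g n - g n)
    double-row g = subst (+ p * + p ∣_) (sym difference) (inner-mod-p² g)
      where
      rearrange : ∀ a i j b → a + i + b + j + b - (+ 2 * (a + i + b) - a) ≡ j - i
      rearrange = solve-∀
      difference : P (n ℕ.+ n) g n - (+ 2 * P n g n - g n) ≡ inner (P n g) - inner g
      difference = begin
          P (n ℕ.+ n) g n - (+ 2 * P n g n - g n)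
        ≡⟨ cong (λ z → z - (+ 2 * P n g n - g n)) (P-compose n g n n) ⟩
          P n (P n g) n - (+ 2 * P n g n - g n)
        ≡⟨ cong (λ z → z - (+ 2 * P n g n - g n)) (P-split (P n g)) ⟩
          P n g n + inner (P n g) + P n g 0 - (+ 2 * P n g n - g n)
        ≡⟨ cong₂ (λ a b → a + inner (P n g) + b - (+ 2 * a - g n)) (P-split g) (P-col0 n g) ⟩
          g n + inner g + g 0 + inner (P n g) + g 0 - (+ 2 * (g n + inner g + g 0) - g n)
        ≡⟨ rearrange (g n) (inner g) (inner (P n g)) (g 0) ⟩
          inner (P n g) - inner g
        ∎
        where open ≡-Reasoning

-- The sum scaled to an integer:  W n = 2^n Σ_{k<n} C(2k,k)/(2^k (2k-1)).
-- Since C(2k,k)/(2k-1) = 4 C(2k-2,k-1) - C(2k,k) for k ≥ 1, the k-th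
-- summand is a k / 2^k with the integer a k below, and W satisfies
-- W (n+1) = 2 (W n + a n).  The sum telescopes into the closed form
--   W (m+1) = 2 R(2m+2, m+1) - 4 C(2m, m).
module ScaledPartialSums where
  open import Data.Nat as ℕ using (ℕ; zero; suc)
  open import Data.Nat.Properties using (+-suc)
  open import Data.Nat.Combinatorics using (_C_)
  open import Data.Integer using (ℤ; +_; _+_; _*_; _-_; 0ℤ; 1ℤ; -1ℤ)
  open import Data.Integer.Properties using (pos-*; pos-+)
  open import Relation.Binary.PropositionalEquality
    using (_≡_; refl; sym; trans; cong; cong₂; module ≡-Reasoning)
  open import Data.Integer.Tactic.RingSolver using (solve-∀)
  open PascalConvolution
  open ImaginaryParts

  odd-numeral : ∀ m → + suc (m ℕ.+ m) ≡ + 2 * + suc m - 1ℤ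
  odd-numeral m = trans (pos-+ 1 (m ℕ.+ m)) (trans (cong (λ z → 1ℤ + z) (pos-+ m m))
                  (trans (double-minus-one (+ m)) (cong (λ z → + 2 * z - 1ℤ) (sym (pos-+ 1 m)))))
    where
    double-minus-one : ∀ a → 1ℤ + (a + a) ≡ + 2 * (1ℤ + a) - 1ℤ
    double-minus-one = solve-∀

  central-recurrenceℤ : ∀ m → let n = suc m in
    + n * C' (n ℕ.+ n) n ≡ + 2 * (+ 2 * + n - 1ℤ) * C' (m ℕ.+ m) m
  central-recurrenceℤ m = begin
      + suc m * C' (suc m ℕ.+ suc m) (suc m)
    ≡⟨ sym (pos-* (suc m) _) ⟩
      + (suc m ℕ.* ((suc m ℕ.+ suc m) C suc m))
    ≡⟨ cong +_ (BinomialFacts.central-recurrence m) ⟩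
      + (2 ℕ.* suc (m ℕ.+ m) ℕ.* ((m ℕ.+ m) C m))
    ≡⟨ trans (pos-* (2 ℕ.* suc (m ℕ.+ m)) _) (cong (_* C' (m ℕ.+ m) m) (pos-* 2 (suc (m ℕ.+ m)))) ⟩
      + 2 * + suc (m ℕ.+ m) * C' (m ℕ.+ m) m
    ≡⟨ cong (λ z → + 2 * z * C' (m ℕ.+ m) m) (odd-numeral m) ⟩
      + 2 * (+ 2 * + suc m - 1ℤ) * C' (m ℕ.+ m) m
    ∎
    where open ≡-Reasoning

  a : ℕ → ℤ
  a zero    = -1ℤ
  a (suc j) = + 4 * C' (j ℕ.+ j) j - C' (suc j ℕ.+ suc j) (suc j)

  a-numerator : ∀ m → a (suc m) * (+ 2 * + suc m - 1ℤ) ≡ C' (suc m ℕ.+ suc m) (suc m)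
  a-numerator m = trans (expand (+ suc m) c c₀)
    (trans (cong (λ v → c + + 2 * (+ 2 * (+ 2 * + suc m - 1ℤ) * c₀ - v)) (central-recurrenceℤ m))
           (cancel c (+ 2 * (+ 2 * + suc m - 1ℤ) * c₀)))
    where
    c : ℤ
    c = C' (suc m ℕ.+ suc m) (suc m)
    c₀ : ℤ
    c₀ = C' (m ℕ.+ m) m
    expand : ∀ n c c₀ → (+ 4 * c₀ - c) * (+ 2 * n - 1ℤ) ≡ c + + 2 * (+ 2 * (+ 2 * n - 1ℤ) * c₀ - n * c)
    expand = solve-∀
    cancel : ∀ c v → c + + 2 * (v - v) ≡ c
    cancel = solve-∀

  W : ℕ → ℤ
  W zero    = 0ℤ
  W (suc n) = + 2 * (W n + a n)

  R-central-step : ∀ m → R (suc (suc m) ℕ.+ suc (suc m)) (suc (suc m))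
                       ≡ + 2 * R (suc m ℕ.+ suc m) (suc m) + C' (suc m ℕ.+ suc m) (suc m)
  R-central-step m = begin
      R (suc (suc m) ℕ.+ suc (suc m)) (suc (suc m))
    ≡⟨ cong (λ z → R z (suc (suc m))) (cong suc (+-suc (suc m) (suc m))) ⟩
      R (suc (suc N)) (suc (suc m))
    ≡⟨ P-pascal (suc N) t (suc m) ⟩
      R (suc N) (suc (suc m)) + R (suc N) (suc m)
    ≡⟨ cong₂ _+_ (P-pascal N t (suc m)) (P-pascal N t m) ⟩
      (R N (suc (suc m)) + R N (suc m)) + (R N (suc m) + R N m)
    ≡⟨ cong (λ z → (z + R N (suc m)) + (R N (suc m) + R N m)) (R-shift N m) ⟩
      ((C' N (suc m) - R N m) + R N (suc m)) + (R N (suc m) + R N m)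
    ≡⟨ collect (C' N (suc m)) (R N m) (R N (suc m)) ⟩
      + 2 * R N (suc m) + C' N (suc m)
    ∎
    where
    open ≡-Reasoning
    N : ℕ
    N = suc m ℕ.+ suc m
    collect : ∀ c r₀ r₁ → ((c - r₀) + r₁) + (r₁ + r₀) ≡ + 2 * r₁ + c
    collect = solve-∀

  W-closed : ∀ m → W (suc m) ≡ + 2 * R (suc m ℕ.+ suc m) (suc m) - + 4 * C' (m ℕ.+ m) m
  W-closed zero    = refl
  W-closed (suc m) rewrite W-closed m | R-central-step m =
    telescope (R (suc m ℕ.+ suc m) (suc m)) (C' (m ℕ.+ m) m) (C' (suc m ℕ.+ suc m) (suc m))
    where
    telescope : ∀ r c₀ c₁ →
      + 2 * ((+ 2 * r - + 4 * c₀) + (+ 4 * c₀ - c₁)) ≡ + 2 * (+ 2 * r + c₁) - + 4 * c₁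
    telescope = solve-∀

module CongruenceAlgebra where
  open import Data.Integer using (ℤ; +_; _+_; _*_; -_; _-_; 1ℤ)
  open import Data.Integer.Properties using (+-identityʳ)
  open import Data.Integer.Divisibility.Signed using (_∣_; ∣n⇒∣m*n; ∣m⇒∣m*n; ∣m∣n⇒∣m-n)
  open import Relation.Binary.PropositionalEquality using (_≡_; sym; trans; cong; subst)
  open import Data.Integer.Tactic.RingSolver using (solve-∀)
  open FiniteSums using (∣-*)

  -- If n c = 2 (2n-1) c₀ with d ∣ n and c ≡ 2 (mod d²), then c₀ ≡ -n (mod d²),
  -- in the form  d² ∣ 2 (n + c₀).
  central-congruence : ∀ {d} n c c₀ → n * c ≡ + 2 * (+ 2 * n - 1ℤ) * c₀ →
    d ∣ n → d * d ∣ c - + 2 → d * d ∣ + 2 * (n + c₀)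
  central-congruence {d} n c c₀ recurrence d∣n d²∣c-2 = subst (d * d ∣_) (sym identity)
    (∣m∣n⇒∣m-n (∣m⇒∣m*n (+ 4 * (+ 2 * c₀ - 1ℤ)) (∣-* d∣n d∣n))
               (∣n⇒∣m*n (+ 2 * n + 1ℤ) (∣n⇒∣m*n n d²∣c-2)))
    where
    expand : ∀ n c c₀ → + 2 * (n + c₀) ≡
      n * n * (+ 4 * (+ 2 * c₀ - 1ℤ)) - (+ 2 * n + 1ℤ) * (n * (c - + 2))
        + (+ 2 * n + 1ℤ) * (n * c - + 2 * (+ 2 * n - 1ℤ) * c₀)
    expand = solve-∀
    cancel : ∀ a q v → a + q * (v - v) ≡ a
    cancel = solve-∀
    identity : + 2 * (n + c₀) ≡ n * n * (+ 4 * (+ 2 * c₀ - 1ℤ)) - (+ 2 * n + 1ℤ) * (n * (c - + 2))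
    identity = trans (expand n c c₀)
      (trans (cong (λ v → n * n * (+ 4 * (+ 2 * c₀ - 1ℤ)) - (+ 2 * n + 1ℤ) * (n * (c - + 2))
                          + (+ 2 * n + 1ℤ) * (v - + 2 * (+ 2 * n - 1ℤ) * c₀)) recurrence)
             (cancel _ (+ 2 * n + 1ℤ) (+ 2 * (+ 2 * n - 1ℤ) * c₀)))

  combine : ∀ {d} x ε n c₀ r → ε * ε ≡ 1ℤ → d ∣ x - ε → d ∣ n →
    d * d ∣ r - (+ 2 * x - ε) → d * d ∣ + 2 * (n + c₀) →
    d * d ∣ + 2 * r - + 4 * c₀ - + 2 * (x * x) * (ε + + 2 * n)
  combine {d} x ε n c₀ r ε²≡1 d∣x-ε d∣n d²∣r d²∣c₀ = subst (d * d ∣_) (sym identity)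
    (∣m∣n⇒∣m-n (∣m∣n⇒∣m-n (∣m∣n⇒∣m-n
      (∣n⇒∣m*n (+ 2) d²∣r)
      (∣n⇒∣m*n (+ 2 * ε) (∣-* d∣x-ε d∣x-ε)))
      (∣n⇒∣m*n (+ 4) (∣m⇒∣m*n (x + ε) (∣-* d∣n d∣x-ε))))
      (∣n⇒∣m*n (+ 2) d²∣c₀))
    where
    S : ℤ
    S = + 2 * (r - (+ 2 * x - ε)) - + 2 * ε * ((x - ε) * (x - ε))
        - + 4 * (n * (x - ε) * (x + ε)) - + 2 * (+ 2 * (n + c₀))
    expand : ∀ x ε n c₀ r → + 2 * r - + 4 * c₀ - + 2 * (x * x) * (ε + + 2 * n) ≡
      + 2 * (r - (+ 2 * x - ε)) - + 2 * ε * ((x - ε) * (x - ε))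
        - + 4 * (n * (x - ε) * (x + ε)) - + 2 * (+ 2 * (n + c₀))
        + (1ℤ - ε * ε) * (+ 4 * x - + 2 * ε + + 4 * n)
    expand = solve-∀
    identity : + 2 * r - + 4 * c₀ - + 2 * (x * x) * (ε + + 2 * n) ≡ S
    identity = trans (expand x ε n c₀ r)
      (trans (cong (λ z → S + (1ℤ - z) * (+ 4 * x - + 2 * ε + + 4 * n)) ε²≡1) (+-identityʳ S))

-- With x = X n (so 2x² = 2^n), ε = t n, c = C(2n,n) and c₀ = C(2n-2,n-1):
-- x ≡ ε (mod p) and R(2n,n) ≡ 2x - ε, c ≡ 2 (mod p²) by the double-row lemma,
-- n c = 2(2n-1) c₀ is the central recurrence, and CongruenceAlgebra concludes.
module IntegerCongruence where
  open import Data.Nat as ℕ using (suc; _<_)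
  open import Data.Nat.Combinatorics using (_C_; nCn≡1)
  import Data.Nat.Divisibility as ℕ
  open import Data.Integer using (ℤ; +_; _+_; _*_; _-_; 0ℤ; 1ℤ)
  open import Data.Integer.Properties using (pos-*; +-identityʳ)
  open import Data.Integer.Divisibility.Signed using (_∣_; ∣ᵤ⇒∣)
  open import Relation.Binary.PropositionalEquality
    using (_≡_; sym; trans; cong; cong₂; subst; subst₂)
  open PascalConvolution
  open ImaginaryParts
  open ScaledPartialSums
  open CongruenceAlgebra

  scaled-sum-congruence : ∀ p k h → (interior : ∀ i → 0 < i → i < suc (suc k) → p ℕ.∣ suc (suc k) C i) →
    suc (suc k) ≡ suc (h ℕ.+ h) → p ℕ.∣ suc (suc k) →
    let n = suc (suc k) in + p * + p ∣ W n - + (2 ℕ.^ n) * (t n + + (2 ℕ.* n))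
  scaled-sum-congruence p k h interior n-odd p∣n = subst (+ p * + p ∣_) (sym rewritten)
    (combine {+ p} (X n) (t n) (+ n) c₀ (R (n ℕ.+ n) n) ε²≡1 x≡ε (∣ᵤ⇒∣ p∣n)
             (double-row t) c₀≡-n)
    where
    open RowSquaring.DoubleRow p k interior using (n; double-row; diagonal-mod-p)
    c₀ : ℤ
    c₀ = C' (suc k ℕ.+ suc k) (suc k)
    ε²≡1 : t n * t n ≡ 1ℤ
    ε²≡1 = subst (λ z → t z * t z ≡ 1ℤ) (sym n-odd) (trans (cong₂ _*_ (t-odd h) (t-odd h)) (sign-square h))
    x≡ε : + p ∣ X n - t n
    x≡ε = subst (λ z → + p ∣ X n - z) (+-identityʳ (t n)) (diagonal-mod-p t)
    c≡2 : + p * + p ∣ C' (n ℕ.+ n) n - + 2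
    c≡2 = subst (λ z → + p * + p ∣ C' (n ℕ.+ n) n - (+ 2 * + z - 0ℤ)) (nCn≡1 n)
            (subst₂ (λ a b → + p * + p ∣ a - (+ 2 * b - 0ℤ)) (P-δ (n ℕ.+ n) n) (P-δ n n) (double-row δ))
    c₀≡-n : + p * + p ∣ + 2 * (+ n + c₀)
    c₀≡-n = central-congruence {+ p} (+ n) (C' (n ℕ.+ n) n) c₀
              (central-recurrenceℤ (suc k)) (∣ᵤ⇒∣ p∣n) c≡2
    rewritten : W n - + (2 ℕ.^ n) * (t n + + (2 ℕ.* n))
              ≡ + 2 * R (n ℕ.+ n) n - + 4 * c₀ - + 2 * (X n * X n) * (t n + + 2 * + n)
    rewritten = cong₂ (λ w e → w - e) (W-closed (suc k))
      (cong₂ _*_ (sym (subst (λ z → + 2 * (X z * X z) ≡ + (2 ℕ.^ z)) (sym n-odd) (X-square-odd h)))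
                 (cong (λ z → t n + z) (pos-* 2 n)))

module OddNumbers where
  open import Data.Nat using (ℕ; zero; suc; _+_; _*_; _^_; _∸_; _/_; nonTrivial⇒≢1; nonTrivial⇒n>1)
  open import Data.Nat.DivMod using (m*n/n≡m)
  open import Data.Nat.Divisibility using (_∣_; divides; ∣1⇒≡1; ∣⇒≤)
  open import Data.Nat.Primality using (Prime; prime⇒irreducible; prime⇒nonTrivial; euclidsLemma)
  open import Data.Nat.Properties using (+-suc; ≤-antisym)
  open import Relation.Nullary using (¬_)
  open import Data.Product using (Σ; _,_)
  open import Data.Sum using (_⊎_; inj₁; inj₂)
  open import Relation.Nullary.Negation using (contradiction)
  open import Relation.Binary.PropositionalEquality using (_≡_; _≢_; refl; sym; trans; cong)
  open import Data.Nat.Tactic.RingSolver using (solve-∀)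

  Odd : ℕ → Set
  Odd n = Σ ℕ (λ h → n ≡ suc (h + h))

  parity : ∀ n → Σ ℕ (λ h → n ≡ h + h) ⊎ Odd n
  parity zero = inj₁ (0 , refl)
  parity (suc n) with parity n
  ... | inj₁ (h , refl) = inj₂ (h , refl)
  ... | inj₂ (h , refl) = inj₁ (suc h , cong suc (sym (+-suc h h)))

  -- An even prime is 2.
  odd-prime : ∀ {p} → Prime p → p ≢ 2 → Odd p
  odd-prime {p} pp p≢2 with parity p
  ... | inj₂ p-odd = p-odd
  ... | inj₁ (h , refl) with prime⇒irreducible pp (divides h (double h))
    where
    double : ∀ h → h + h ≡ h * 2
    double = solve-∀
  ... | inj₁ ()
  ... | inj₂ 2≡p = contradiction (sym 2≡p) p≢2

  odd-* : ∀ {a b} → Odd a → Odd b → Odd (a * b)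
  odd-* (g , refl) (h , refl) = g * h + g * h + g + h , expand g h
    where
    expand : ∀ g h → suc (g + g) * suc (h + h) ≡ suc ((g * h + g * h + g + h) + (g * h + g * h + g + h))
    expand = solve-∀

  odd-^ : ∀ {p} → Odd p → ∀ r → Odd (p ^ r)
  odd-^ p-odd zero    = 0 , refl
  odd-^ p-odd (suc r) = odd-* p-odd (odd-^ p-odd r)

  odd-prime∤2^ : ∀ {p} → Prime p → p ≢ 2 → ∀ n → ¬ p ∣ 2 ^ n
  odd-prime∤2^ pp p≢2 zero    p∣1 = nonTrivial⇒≢1 {{prime⇒nonTrivial pp}} (∣1⇒≡1 p∣1)
  odd-prime∤2^ {p} pp p≢2 (suc n) p∣2^n+1 with euclidsLemma 2 (2 ^ n) pp p∣2^n+1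
  ... | inj₁ p∣2   = p≢2 (≤-antisym (∣⇒≤ p∣2) (nonTrivial⇒n>1 p {{prime⇒nonTrivial pp}}))
  ... | inj₂ p∣2^n = odd-prime∤2^ pp p≢2 n p∣2^n

  half-odd : ∀ h → (suc (h + h) ∸ 1) / 2 ≡ h
  half-odd h = trans (cong (_/ 2) (double h)) (m*n/n≡m h 2)
    where
    double : ∀ h → h + h ≡ h * 2
    double = solve-∀

module PrimePowerCongruence where
  open import Data.Nat as ℕ using (ℕ; zero; suc; _^_; _∸_; _/_; _<_; nonTrivial⇒≢1)
  open import Data.Nat.Divisibility using (_∣_; ∣1⇒≡1; m∣m*n)
  open import Data.Nat.Combinatorics using (_C_)
  open import Relation.Nullary.Negation using (contradiction)
  open import Data.Nat.Primality using (Prime; prime⇒nonTrivial)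
  open import Data.Integer using (+_; _-_; _*_; -1ℤ) renaming (_^_ to _^ℤ_; _+_ to _+ℤ_)
  open import Data.Integer.Divisibility.Signed using () renaming (_∣_ to _∣ℤ_)
  open import Relation.Binary.PropositionalEquality using (_≡_; _≢_; refl; sym; trans; cong; subst)
  open import Data.Product using (_,_)
  open ImaginaryParts using (t; t-odd)
  open ScaledPartialSums using (W)
  open IntegerCongruence using (scaled-sum-congruence)
  open OddNumbers

  prime-power-congruence : ∀ p r → Prime p → p ≢ 2 → 0 < r → let n = p ^ r in
    + p * + p ∣ℤ W n - + (2 ^ n) * (-1ℤ ^ℤ ((n ∸ 1) / 2) +ℤ + (2 ℕ.* n))
  prime-power-congruence p (suc r) pp p≢2 _ with odd-^ (odd-prime pp p≢2) (suc r)
  ... | zero  , p^r≡1 =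
    contradiction (∣1⇒≡1 (subst (p ∣_) p^r≡1 p∣p^r)) (nonTrivial⇒≢1 {{prime⇒nonTrivial pp}})
    where
    p∣p^r : p ∣ p ^ suc r
    p∣p^r = m∣m*n (p ^ r)
  ... | suc h , p^r≡n = subst goal (sym p^r≡n)
          (subst (λ e → + p * + p ∣ℤ W n - + (2 ^ n) * (e +ℤ + (2 ℕ.* n))) sign
            (scaled-sum-congruence p (h ℕ.+ suc h) (suc h) interior refl p∣n))
    where
    goal : ℕ → Set
    goal n = + p * + p ∣ℤ W n - + (2 ^ n) * (-1ℤ ^ℤ ((n ∸ 1) / 2) +ℤ + (2 ℕ.* n))
    n : ℕ
    n = suc (suc h ℕ.+ suc h)
    sign : t n ≡ -1ℤ ^ℤ ((n ∸ 1) / 2)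
    sign = trans (t-odd (suc h)) (cong (-1ℤ ^ℤ_) (sym (half-odd (suc h))))
    interior : ∀ i → 0 < i → i < n → p ∣ n C i
    interior i 0<i i<n = subst (λ m → p ∣ m C i) p^r≡n
      (BinomialFacts.prime-power-binomial pp (suc r) i 0<i (subst (i <_) (sym p^r≡n) i<n))
    p∣n : p ∣ n
    p∣n = subst (p ∣_) p^r≡n (m∣m*n (p ^ r))

-- Rationals are compared through the
-- unnormalised fractions of Data.Rational.Unnormalised, where every
-- identity between fractions reduces to cross-multiplication in ℤ.
module RationalValue where
  open import Data.Nat as ℕ using (ℕ; zero; suc; NonZero)
  open import Data.Nat.Properties using (m^n≢0; m*n≢0; +-identityʳ; *-identityʳ)
  open import Data.Nat.Combinatorics using (_C_)
  open import Data.Integer as ℤ using (ℤ; +_; 1ℤ)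
  import Data.Integer.Properties as ℤ
  open import Data.Rational as ℚ using (ℚ; toℚᵘ)
  import Data.Rational.Properties as ℚ
  open import Data.Rational.Unnormalised as ℚᵘ using (mkℚᵘ; *≡*; _≃_)
  import Data.Rational.Unnormalised.Properties as ℚᵘ
  open import Data.List using ([]; _∷_; _∷ʳ_; map; upTo)
  open import Data.List.Properties using (map-++; upTo-∷ʳ)
  open import Relation.Binary.PropositionalEquality
    using (_≡_; refl; sym; trans; cong; module ≡-Reasoning)
  open import Data.Integer.Tactic.RingSolver using (solve-∀)
  open ScaledPartialSums using (a; W; a-numerator; odd-numeral)
  open PascalConvolution using (C')

  2^≢0 : ∀ n → NonZero (2 ℕ.^ n)
  2^≢0 n = m^n≢0 2 n

  /-cross : ∀ i j d e .{{_ : NonZero d}} .{{_ : NonZero e}} →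
    i ℤ.* + e ≡ j ℤ.* + d → (i ℚᵘ./ d) ≃ (j ℚᵘ./ e)
  /-cross i j (suc d) (suc e) eq = *≡* eq

  /-+ : ∀ i j d e .{{_ : NonZero d}} .{{_ : NonZero e}} →
    (i ℚᵘ./ d) ℚᵘ.+ (j ℚᵘ./ e) ≡ ((i ℤ.* + e ℤ.+ j ℤ.* + d) ℚᵘ./ (d ℕ.* e)) {{m*n≢0 d e}}
  /-+ i j (suc d) (suc e) = refl

  /-* : ∀ i j d e .{{_ : NonZero d}} .{{_ : NonZero e}} →
    (i ℚᵘ./ d) ℚᵘ.* (j ℚᵘ./ e) ≡ ((i ℤ.* j) ℚᵘ./ (d ℕ.* e)) {{m*n≢0 d e}}
  /-* i j (suc d) (suc e) = refl

  /-neg : ∀ i d .{{_ : NonZero d}} → ℚᵘ.- (i ℚᵘ./ d) ≡ (ℤ.- i) ℚᵘ./ d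
  /-neg i (suc d) = refl

  toℚᵘ-/ : ∀ i d .{{_ : NonZero d}} → toℚᵘ (i ℚ./ d) ≃ (i ℚᵘ./ d)
  toℚᵘ-/ i (suc d) = ℚ.toℚᵘ-fromℚᵘ (mkℚᵘ i d)

  fromℚᵘ-/ : ∀ {q} i d .{{_ : NonZero d}} → toℚᵘ q ≃ (i ℚᵘ./ d) → q ≡ i ℚ./ d
  fromℚᵘ-/ {q} i (suc d) q≃i/d = trans (sym (ℚ.fromℚᵘ-toℚᵘ q)) (ℚ.fromℚᵘ-cong q≃i/d)

  sumℚ-∷ʳ : ∀ xs y → sumℚ (xs ∷ʳ y) ≡ sumℚ xs ℚ.+ y
  sumℚ-∷ʳ []       y = trans (ℚ.+-identityʳ y) (sym (ℚ.+-identityˡ y))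
  sumℚ-∷ʳ (x ∷ xs) y = trans (cong (x ℚ.+_) (sumℚ-∷ʳ xs y)) (sym (ℚ.+-assoc x (sumℚ xs) y))

  Σ<ℚ-suc : ∀ n f → Σ<ℚ (suc n) f ≡ Σ<ℚ n f ℚ.+ f n
  Σ<ℚ-suc n f = begin
      sumℚ (map f (upTo (suc n)))
    ≡⟨ cong (λ xs → sumℚ (map f xs)) (sym (upTo-∷ʳ n)) ⟩
      sumℚ (map f (upTo n ∷ʳ n))
    ≡⟨ cong sumℚ (map-++ f (upTo n) (n ∷ [])) ⟩
      sumℚ (map f (upTo n) ∷ʳ f n)
    ≡⟨ sumℚ-∷ʳ (map f (upTo n)) (f n) ⟩
      Σ<ℚ n f ℚ.+ f n
    ∎
    where open ≡-Reasoning

  -- Cross-multiplied form of  C(2i+2,i+1) / (2^(i+1) (2i+1)) = a (i+1) / 2^(i+1).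
  summand-cross : ∀ i → let D = 2 ℕ.^ suc i; s = suc (2 ℕ.* i) in
    + ((2 ℕ.* suc i) C suc i) ℤ.* + 1 ℤ.* + D ≡ a (suc i) ℤ.* + (D ℕ.* s)
  summand-cross i = begin
      + ((2 ℕ.* suc i) C suc i) ℤ.* + 1 ℤ.* + D
    ≡⟨ cong (λ m → + (m C suc i) ℤ.* + 1 ℤ.* + D) (cong (suc i ℕ.+_) (+-identityʳ (suc i))) ⟩
      C' (suc i ℕ.+ suc i) (suc i) ℤ.* + 1 ℤ.* + D
    ≡⟨ cong (λ z → z ℤ.* + 1 ℤ.* + D) (sym (a-numerator i)) ⟩
      a (suc i) ℤ.* (+ 2 ℤ.* + suc i ℤ.- 1ℤ) ℤ.* + 1 ℤ.* + D
    ≡⟨ regroup (a (suc i)) _ (+ D) ⟩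
      a (suc i) ℤ.* (+ D ℤ.* (+ 2 ℤ.* + suc i ℤ.- 1ℤ))
    ≡⟨ cong (λ z → a (suc i) ℤ.* (+ D ℤ.* z)) (sym s-numeral) ⟩
      a (suc i) ℤ.* (+ D ℤ.* + s)
    ≡⟨ cong (a (suc i) ℤ.*_) (sym (ℤ.pos-* D s)) ⟩
      a (suc i) ℤ.* + (D ℕ.* s)
    ∎
    where
    open ≡-Reasoning
    D : ℕ
    D = 2 ℕ.^ suc i
    s : ℕ
    s = suc (2 ℕ.* i)
    s-numeral : + s ≡ + 2 ℤ.* + suc i ℤ.- 1ℤ
    s-numeral = trans (cong (λ j → + suc (i ℕ.+ j)) (+-identityʳ i)) (odd-numeral i)
    regroup : ∀ a s d → a ℤ.* s ℤ.* + 1 ℤ.* d ≡ a ℤ.* (d ℤ.* s)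
    regroup = solve-∀

  term-value : ∀ j → toℚᵘ (term j) ≃ (a j ℚᵘ./ 2 ℕ.^ j) {{2^≢0 j}}
  term-value zero    = ℚᵘ.≃-refl
  term-value (suc i) = begin
      toℚᵘ (x ℚ.* y)
    ≈⟨ ℚ.toℚᵘ-homo-* x y ⟩
      toℚᵘ x ℚᵘ.* toℚᵘ y
    ≈⟨ ℚᵘ.*-cong (toℚᵘ-/ c D {{2^≢0 (suc i)}}) (toℚᵘ-/ (+ 1) s) ⟩
      (c ℚᵘ./ D) {{2^≢0 (suc i)}} ℚᵘ.* (+ 1 ℚᵘ./ s)
    ≡⟨ /-* c (+ 1) D s {{2^≢0 (suc i)}} ⟩
      ((c ℤ.* + 1) ℚᵘ./ (D ℕ.* s)) {{m*n≢0 D s {{2^≢0 (suc i)}}}}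
    ≈⟨ /-cross _ _ (D ℕ.* s) D {{m*n≢0 D s {{2^≢0 (suc i)}}}} {{2^≢0 (suc i)}} (summand-cross i) ⟩
      (a (suc i) ℚᵘ./ D) {{2^≢0 (suc i)}}
    ∎
    where
    open ℚᵘ.≃-Reasoning
    D : ℕ
    D = 2 ℕ.^ suc i
    s : ℕ
    s = suc (2 ℕ.* i)
    c : ℤ
    c = + ((2 ℕ.* suc i) C suc i)
    x : ℚ
    x = (c ℚ./ D) {{2^≢0 (suc i)}}
    y : ℚ
    y = + 1 ℚ./ s

  partial-sum-value : ∀ n → toℚᵘ (Σ<ℚ n term) ≃ (W n ℚᵘ./ 2 ℕ.^ n) {{2^≢0 n}}
  partial-sum-value zero    = ℚᵘ.≃-refl
  partial-sum-value (suc n) = begin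
      toℚᵘ (Σ<ℚ (suc n) term)
    ≡⟨ cong toℚᵘ (Σ<ℚ-suc n term) ⟩
      toℚᵘ (Σ<ℚ n term ℚ.+ term n)
    ≈⟨ ℚ.toℚᵘ-homo-+ (Σ<ℚ n term) (term n) ⟩
      toℚᵘ (Σ<ℚ n term) ℚᵘ.+ toℚᵘ (term n)
    ≈⟨ ℚᵘ.+-cong (partial-sum-value n) (term-value n) ⟩
      (W n ℚᵘ./ D) {{2^≢0 n}} ℚᵘ.+ (a n ℚᵘ./ D) {{2^≢0 n}}
    ≡⟨ /-+ (W n) (a n) D D {{2^≢0 n}} {{2^≢0 n}} ⟩
      ((W n ℤ.* + D ℤ.+ a n ℤ.* + D) ℚᵘ./ (D ℕ.* D)) {{m*n≢0 D D {{2^≢0 n}} {{2^≢0 n}}}}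
    ≈⟨ /-cross _ _ (D ℕ.* D) (2 ℕ.^ suc n) {{m*n≢0 D D {{2^≢0 n}} {{2^≢0 n}}}} {{2^≢0 (suc n)}} cross ⟩
      (W (suc n) ℚᵘ./ 2 ℕ.^ suc n) {{2^≢0 (suc n)}}
    ∎
    where
    open ℚᵘ.≃-Reasoning
    D : ℕ
    D = 2 ℕ.^ n
    regroup : ∀ w x d → (w ℤ.* d ℤ.+ x ℤ.* d) ℤ.* (+ 2 ℤ.* d) ≡ (+ 2 ℤ.* (w ℤ.+ x)) ℤ.* (d ℤ.* d)
    regroup = solve-∀
    cross : (W n ℤ.* + D ℤ.+ a n ℤ.* + D) ℤ.* + (2 ℕ.^ suc n) ≡ W (suc n) ℤ.* + (D ℕ.* D)
    cross = trans (cong (λ z → (W n ℤ.* + D ℤ.+ a n ℤ.* + D) ℤ.* z) (ℤ.pos-* 2 D))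
           (trans (regroup (W n) (a n) (+ D)) (cong (W (suc n) ℤ.*_) (sym (ℤ.pos-* D D))))

  difference-value : ∀ n e → Σ<ℚ n term ℚ.- (e ℚ./ 1 ℚ.+ + (2 ℕ.* n) ℚ./ 1)
                           ≡ ((W n ℤ.- + (2 ℕ.^ n) ℤ.* (e ℤ.+ + (2 ℕ.* n))) ℚ./ 2 ℕ.^ n) {{2^≢0 n}}
  difference-value n e = fromℚᵘ-/ _ D {{2^≢0 n}} (begin
      toℚᵘ (Σ<ℚ n term ℚ.- E)
    ≈⟨ ℚ.toℚᵘ-homo-+ (Σ<ℚ n term) (ℚ.- E) ⟩
      toℚᵘ (Σ<ℚ n term) ℚᵘ.+ toℚᵘ (ℚ.- E)
    ≈⟨ ℚᵘ.+-cong (partial-sum-value n) (ℚᵘ.≃-trans (ℚ.toℚᵘ-homo‿- E) (ℚᵘ.-‿cong E-value)) ⟩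
      (W n ℚᵘ./ D) {{2^≢0 n}} ℚᵘ.+ ℚᵘ.- (e′ ℚᵘ./ 1)
    ≡⟨ cong ((W n ℚᵘ./ D) {{2^≢0 n}} ℚᵘ.+_) (/-neg e′ 1) ⟩
      (W n ℚᵘ./ D) {{2^≢0 n}} ℚᵘ.+ (ℤ.- e′ ℚᵘ./ 1)
    ≡⟨ /-+ (W n) (ℤ.- e′) D 1 {{2^≢0 n}} ⟩
      ((W n ℤ.* + 1 ℤ.+ ℤ.- e′ ℤ.* + D) ℚᵘ./ (D ℕ.* 1)) {{m*n≢0 D 1 {{2^≢0 n}}}}
    ≈⟨ /-cross _ _ (D ℕ.* 1) D {{m*n≢0 D 1 {{2^≢0 n}}}} {{2^≢0 n}} cross ⟩
      ((W n ℤ.- + D ℤ.* (e ℤ.+ + (2 ℕ.* n))) ℚᵘ./ D) {{2^≢0 n}}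
    ∎)
    where
    open ℚᵘ.≃-Reasoning
    D : ℕ
    D = 2 ℕ.^ n
    E : ℚ
    E = e ℚ./ 1 ℚ.+ + (2 ℕ.* n) ℚ./ 1
    e′ : ℤ
    e′ = e ℤ.* + 1 ℤ.+ + (2 ℕ.* n) ℤ.* + 1
    E-value : toℚᵘ E ≃ (e′ ℚᵘ./ 1)
    E-value = ℚᵘ.≃-trans (ℚ.toℚᵘ-homo-+ (e ℚ./ 1) _)
                         (ℚᵘ.+-cong (toℚᵘ-/ e 1) (toℚᵘ-/ (+ (2 ℕ.* n)) 1))
    regroup : ∀ w e t d →
      (w ℤ.* + 1 ℤ.+ ℤ.- (e ℤ.* + 1 ℤ.+ t ℤ.* + 1) ℤ.* d) ℤ.* d ≡ (w ℤ.- d ℤ.* (e ℤ.+ t)) ℤ.* d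
    regroup = solve-∀
    cross : (W n ℤ.* + 1 ℤ.+ ℤ.- e′ ℤ.* + D) ℤ.* + D
          ≡ (W n ℤ.- + D ℤ.* (e ℤ.+ + (2 ℕ.* n))) ℤ.* + (D ℕ.* 1)
    cross = trans (regroup (W n) e (+ (2 ℕ.* n)) (+ D))
                  (cong (λ z → (W n ℤ.- + D ℤ.* (e ℤ.+ + (2 ℕ.* n))) ℤ.* + z) (sym (*-identityʳ D)))

module FractionCongruence where
  open import Data.Nat as ℕ using (ℕ; _^_; NonZero)
  open import Data.Nat.Properties using (*-comm)
  open import Data.Nat.Divisibility using (_∣_; divides; ∣-trans)
  open import Data.Nat.GCD using (gcd; gcd[m,n]∣n)
  open import Data.Nat.Coprimality using (Coprime)
  open import Data.Nat.Primality using (Prime; prime⇒irreducible)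
  open import Data.Integer as ℤ using (+_; ∣_∣)
  import Data.Integer.Properties as ℤ
  open import Data.Rational using (_/_; ↥_; ↧ₙ_)
  import Data.Rational.Properties as ℚ
  open import Data.Product using (_×_; _,_)
  open import Data.Sum using (inj₁; inj₂)
  open import Relation.Nullary using (¬_)
  open import Relation.Nullary.Negation using (contradiction)
  open import Relation.Binary.PropositionalEquality using (_≡_; refl; sym; trans; cong; subst)

  fraction-≡0 : ∀ {p} e M d .{{_ : NonZero d}} → Prime p → p ^ e ∣ ∣ M ∣ → ¬ p ∣ d →
    (p ^ e ∣ ∣ ↥ (M / d) ∣) × Coprime (↧ₙ (M / d)) p
  fraction-≡0 {p} e M d pp p^e∣M p∤d = numerator , denominator
    where
    g : ℕ
    g = gcd ∣ M ∣ d
    -- Normalisation divides numerator and denominator by g, which divides d.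
    p∤g : ¬ p ∣ g
    p∤g p∣g = p∤d (∣-trans p∣g (gcd[m,n]∣n ∣ M ∣ d))
    numerator-scaled : ∣ ↥ (M / d) ∣ ℕ.* g ≡ ∣ M ∣
    numerator-scaled = trans (sym (ℤ.abs-* (↥ (M / d)) (+ g))) (cong ∣_∣ (ℚ.↥-/ M d))
    numerator : p ^ e ∣ ∣ ↥ (M / d) ∣
    numerator = BinomialFacts.prime-power-cancel pp e _ g p∤g
                  (subst (p ^ e ∣_) (sym numerator-scaled) p^e∣M)
    denominator-scaled : ↧ₙ (M / d) ℕ.* g ≡ d
    denominator-scaled = ℤ.+-injective (trans (ℤ.pos-* (↧ₙ (M / d)) g) (ℚ.↧-/ M d))
    denominator : Coprime (↧ₙ (M / d)) p
    denominator {c} (c∣den , c∣p) with prime⇒irreducible pp c∣p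
    ... | inj₁ c≡1 = c≡1
    ... | inj₂ refl = contradiction (∣-trans c∣den (divides g (trans (sym denominator-scaled) (*-comm _ g)))) p∤d

open import Data.Nat using (ℕ; _^_; _∸_; _*_; _>_)
open import Data.Nat.Primality using (Prime)
open import Relation.Binary.PropositionalEquality using (_≢_)
open import Data.Integer using (+_; -1ℤ)
open import Data.Rational using (ℚ; _+_)
import Data.Nat as ℕ
import Data.Integer as ℤ
import Data.Rational as ℚ
import Data.Integer.Properties as ℤ
open import Data.Integer.Divisibility.Signed using (∣⇒∣ᵤ)
open import Data.Nat.Properties using (*-identityʳ)
open import Data.Nat.Divisibility using (_∣_)
open import Data.Nat.Coprimality using (Coprime)
open import Data.Product using (_×_)
open import Relation.Binary.PropositionalEquality using (sym; trans; cong; subst)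

-- The difference is W n - 2^n (ε + 2n) over 2^n; its numerator is divisible by
-- p² (PrimePowerCongruence) and its denominator is prime to p.
corollary1p1 : (p r : ℕ) → Prime p → p ≢ 2 → r > 0 →
    Σ<ℚ (p ^ r) term ≡ (-1ℤ ℤ.^ ((p ^ r ∸ 1) ℕ./ 2)) ℚ./ 1 + (+ (2 * p ^ r)) ℚ./ 1 [mod p ^ 2 ]
corollary1p1 p r pp p≢2 r>0 =
  subst (λ q → (p ^ 2 ∣ ℤ.∣ ℚ.↥ q ∣) × Coprime (ℚ.↧ₙ q) p)
    (sym (RationalValue.difference-value n ε))
    (FractionCongruence.fraction-≡0 2 numerator (2 ^ n) {{RationalValue.2^≢0 n}} pp p²∣numerator
      (OddNumbers.odd-prime∤2^ pp p≢2 n))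
  where
  n : ℕ
  n = p ^ r
  ε : ℤ.ℤ
  ε = -1ℤ ℤ.^ ((n ∸ 1) ℕ./ 2)
  numerator : ℤ.ℤ
  numerator = ScaledPartialSums.W n ℤ.- + (2 ^ n) ℤ.* (ε ℤ.+ + (2 * n))
  -- The integer congruence, with the modulus + p * + p read as p ^ 2 in ℕ.
  p²∣numerator : p ^ 2 ∣ ℤ.∣ numerator ∣
  p²∣numerator = subst (_∣ ℤ.∣ numerator ∣) (trans (ℤ.abs-* (+ p) (+ p)) (cong (p *_) (sym (*-identityʳ p))))
    (∣⇒∣ᵤ (PrimePowerCongruence.prime-power-congruence p r pp p≢2 r>0))
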